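{- Let $x_1,\dots,x_m,a,b,c,d$ be positive integers with $a\le b\le c\le d$, and define the multisets $S=\{x_1,\dots,x_m,a+b,a+b,c+d,c+d\}$, $T=\{x_1,\dots,x_m,a+c,a+c,b+d,b+d\}$, $U=\{x_1,\dots,x_m,a+d,a+d,b+c,b+c\}$. Then $S\le T$ and $S\le U$.
   Context: One-player game: Alice has sheets of paper, each with a positive integer written on it. A move consists of choosing two sheets, with numbers $a$ and $b$, erasing them and writing $a+b$ on both sheets. The configuration is the multiset of the numbers on the sheets. $opt(S,k)$ is the smallest possible sum of the numbers after exactly $k$ moves starting from configuration $S$. For multisets $S,T$ of the same size, $S\le T$ means $opt(S,k)\le opt(T,k)$ for every integer $k\ge 0$. -}

module Defs where

open import Data.Nat using (ℕ; zero; suc; _+_; _≤_)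
open import Data.Fin using (Fin)
open import Data.Vec using (Vec; lookup; _[_]≔_; sum)
open import Data.Product using (Σ; ∃; _×_; _,_)
open import Relation.Binary.PropositionalEquality using (_≡_; _≢_)

-- A configuration of n sheets is a vector of n numbers; the multiset is its
-- underlying multiset (all notions below are invariant under permuting entries).

Move : {n : ℕ} → Vec ℕ n → Vec ℕ n → Set
Move {n} v w =
  Σ (Fin n) λ i → Σ (Fin n) λ j → (i ≢ j) ×
    (w ≡ ((v [ i ]≔ (lookup v i + lookup v j)) [ j ]≔ (lookup v i + lookup v j)))

data Reach {n : ℕ} : ℕ → Vec ℕ n → Vec ℕ n → Set where
  done : ∀ {v} → Reach zero v v
  step : ∀ {k u v w} → Move u v → Reach k v w → Reach (suc k) u w

-- IsOpt S k o : o = opt(S,k), the smallest possible sum after exactly k moves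
-- (o is attained by some configuration reachable in k moves, and is a lower
-- bound on the sums of all such configurations).
IsOpt : {n : ℕ} → Vec ℕ n → ℕ → ℕ → Set
IsOpt {n} S k o =
  (∃ λ w → Reach k S w × sum w ≡ o) × (∀ w → Reach k S w → o ≤ sum w)

_≼_ : {n : ℕ} → Vec ℕ n → Vec ℕ n → Set
S ≼ T = ∀ k o o′ → IsOpt S k o → IsOpt T k o′ → o ≤ o′

-- A move is linear in the configuration, so once the moves of a play are
-- fixed, the final sum F is a linear function of the starting vector. Write
-- the pairs of S as x, x + δ + ε and those of T as x + δ, x + ε, and let e₁, e₂
-- be the indicator vectors of the two pair positions. Then
-- T + δ e₂ = S + δ e₁ and T + ε e₁ = S′ + ε e₂, where S′ is S with its pairs
-- exchanged, so replaying the moves of an optimal play from T on S or on S′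
-- ends with sum at most F T, according to the sign of F e₁ − F e₂. Finally S′
-- is a rearrangement of S, which moves cannot distinguish.
module Submission where

open import Defs
open import Data.Nat using (ℕ; _+_; _≤_; _<_)
open import Data.Vec using (Vec; _∷_; []; _++_)
open import Data.Vec.Relation.Unary.All using (All)
open import Data.Product using (_×_)

open import Data.Nat using (zero; suc; _*_)
open import Data.Nat.Properties
  using ( +-commutativeSemigroup; +-0-commutativeMonoid; +-assoc; +-identityʳ; *-zeroʳ; *-distribˡ-+
        ; ≤-trans; ≤-total; +-monoʳ-≤; *-monoʳ-≤; +-cancelʳ-≤; m≤n⇒∃[o]m+o≡n; module ≤-Reasoning)
open import Data.Nat.Tactic.RingSolver using (solve-∀)
open import Algebra.Properties.CommutativeSemigroup +-commutativeSemigroup using (interchange)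
import Algebra.Properties.CommutativeMonoid.Sum +-0-commutativeMonoid as Finite
open import Data.Fin using (Fin; zero; suc; _≟_)
open import Data.Fin.Permutation
  using (Permutation′; _⟨$⟩ʳ_; _⟨$⟩ˡ_; inverseˡ; inverseʳ; lift₀; reverse)
open import Data.Product using (∃-syntax; _,_)
open import Data.Sum using (_⊎_; inj₁; inj₂)
open import Data.Vec using (lookup; _[_]≔_; sum; zipWith; map; replicate; tabulate)
open import Data.Vec.Properties
  using (lookup∘update; lookup∘update′; lookup-map; lookup-zipWith; map-[]≔; lookup∘tabulate)
open import Data.Vec.Relation.Binary.Pointwise.Extensional using (ext; Pointwise-≡⇒≡)
open import Function using (_∘_)
open import Relation.Binary.PropositionalEquality
open import Relation.Nullary using (yes; no)

private variable
  A B C : Set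
  m n k : ℕ

infixl 6 _⊕_
infixr 7 _·_

_⊕_ : Vec ℕ n → Vec ℕ n → Vec ℕ n
_⊕_ = zipWith _+_

_·_ : ℕ → Vec ℕ n → Vec ℕ n
c · v = map (c *_) v

sum-⊕ : (u v : Vec ℕ n) → sum (u ⊕ v) ≡ sum u + sum v
sum-⊕ []      []      = refl
sum-⊕ (a ∷ u) (b ∷ v) = trans (cong (a + b +_) (sum-⊕ u v)) (interchange a b (sum u) (sum v))

sum-· : ∀ c (v : Vec ℕ n) → sum (c · v) ≡ c * sum v
sum-· c []      = sym (*-zeroʳ c)
sum-· c (a ∷ v) = trans (cong (c * a +_) (sum-· c v)) (sym (*-distribˡ-+ c a (sum v)))

zipWith-[]≔ : ∀ (f : A → B → C) (u : Vec A n) (v : Vec B n) i x y →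
              zipWith f (u [ i ]≔ x) (v [ i ]≔ y) ≡ zipWith f u v [ i ]≔ f x y
zipWith-[]≔ f (a ∷ u) (b ∷ v) zero    x y = refl
zipWith-[]≔ f (a ∷ u) (b ∷ v) (suc i) x y = cong (f a b ∷_) (zipWith-[]≔ f u v i x y)

⊕-·-++-zeros : ∀ (xs : Vec ℕ m) (ys zs : Vec ℕ n) c →
               (xs ++ ys) ⊕ c · (replicate m 0 ++ zs) ≡ xs ++ (ys ⊕ c · zs)
⊕-·-++-zeros []       ys zs c = refl
⊕-·-++-zeros (x ∷ xs) ys zs c =
  cong₂ _∷_ (trans (cong (x +_) (*-zeroʳ c)) (+-identityʳ x)) (⊕-·-++-zeros xs ys zs c)

permute : Permutation′ n → Vec A n → Vec A n
permute ρ v = tabulate (lookup v ∘ (ρ ⟨$⟩ʳ_))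

lookup-permute : ∀ (ρ : Permutation′ n) (v : Vec A n) i → lookup (permute ρ v) i ≡ lookup v (ρ ⟨$⟩ʳ i)
lookup-permute ρ v = lookup∘tabulate (lookup v ∘ (ρ ⟨$⟩ʳ_))

lookup-permute-⟨$⟩ˡ : ∀ (ρ : Permutation′ n) (v : Vec A n) i → lookup (permute ρ v) (ρ ⟨$⟩ˡ i) ≡ lookup v i
lookup-permute-⟨$⟩ˡ ρ v i = trans (lookup-permute ρ v (ρ ⟨$⟩ˡ i)) (cong (lookup v) (inverseʳ ρ))

sum≡∑lookup : (v : Vec ℕ n) → sum v ≡ Finite.sum (lookup v)
sum≡∑lookup []      = refl
sum≡∑lookup (a ∷ v) = cong (a +_) (sum≡∑lookup v)

sum-permute : ∀ (ρ : Permutation′ n) (v : Vec ℕ n) → sum (permute ρ v) ≡ sum v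
sum-permute ρ v = begin
  sum (permute ρ v)                  ≡⟨ sum≡∑lookup (permute ρ v) ⟩
  Finite.sum (lookup (permute ρ v))  ≡⟨ Finite.sum-cong-≗ (lookup-permute ρ v) ⟩
  Finite.sum (lookup v ∘ (ρ ⟨$⟩ʳ_))  ≡⟨ Finite.sum-permute (lookup v) ρ ⟨
  Finite.sum (lookup v)              ≡⟨ sum≡∑lookup v ⟨
  sum v                              ∎
  where open ≡-Reasoning

permute-[]≔ : ∀ (ρ : Permutation′ n) (v : Vec A n) i x →
              permute ρ (v [ i ]≔ x) ≡ permute ρ v [ ρ ⟨$⟩ˡ i ]≔ x
permute-[]≔ ρ v i x = Pointwise-≡⇒≡ (ext pointwise)
  where
  open ≡-Reasoning
  pointwise : ∀ k → lookup (permute ρ (v [ i ]≔ x)) k ≡ lookup (permute ρ v [ ρ ⟨$⟩ˡ i ]≔ x) k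
  pointwise k with k ≟ ρ ⟨$⟩ˡ i
  ... | yes refl = begin
    lookup (permute ρ (v [ i ]≔ x)) (ρ ⟨$⟩ˡ i)  ≡⟨ lookup-permute-⟨$⟩ˡ ρ (v [ i ]≔ x) i ⟩
    lookup (v [ i ]≔ x) i                       ≡⟨ lookup∘update i v x ⟩
    x                                           ≡⟨ lookup∘update (ρ ⟨$⟩ˡ i) (permute ρ v) x ⟨
    lookup (permute ρ v [ ρ ⟨$⟩ˡ i ]≔ x) (ρ ⟨$⟩ˡ i) ∎
  ... | no k≢ρˡi = begin
    lookup (permute ρ (v [ i ]≔ x)) k       ≡⟨ lookup-permute ρ (v [ i ]≔ x) k ⟩
    lookup (v [ i ]≔ x) (ρ ⟨$⟩ʳ k)          ≡⟨ lookup∘update′ ρʳk≢i v x ⟩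
    lookup v (ρ ⟨$⟩ʳ k)                     ≡⟨ lookup-permute ρ v k ⟨
    lookup (permute ρ v) k                  ≡⟨ lookup∘update′ k≢ρˡi (permute ρ v) x ⟨
    lookup (permute ρ v [ ρ ⟨$⟩ˡ i ]≔ x) k  ∎
    where
    ρʳk≢i : ρ ⟨$⟩ʳ k ≢ i
    ρʳk≢i e = k≢ρˡi (trans (sym (inverseˡ ρ)) (cong (ρ ⟨$⟩ˡ_) e))

onSuffix : ∀ m → Permutation′ n → Permutation′ (m + n)
onSuffix zero    ρ = ρ
onSuffix (suc m) ρ = lift₀ (onSuffix m ρ)

permute-onSuffix : ∀ (ρ : Permutation′ n) (xs : Vec A m) ys →
                   permute (onSuffix m ρ) (xs ++ ys) ≡ xs ++ permute ρ ys
permute-onSuffix ρ []       ys = refl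
permute-onSuffix ρ (x ∷ xs) ys = cong (x ∷_) (permute-onSuffix ρ xs ys)

move : Fin n → Fin n → Vec ℕ n → Vec ℕ n
move i j v = let s = lookup v i + lookup v j in (v [ i ]≔ s) [ j ]≔ s

move-map : ∀ (f : ℕ → ℕ) → (∀ a b → f (a + b) ≡ f a + f b) →
           ∀ i j (v : Vec ℕ n) → map f (move i j v) ≡ move i j (map f v)
move-map f f-+ i j v = begin
  map f ((v [ i ]≔ s) [ j ]≔ s)      ≡⟨ map-[]≔ f (v [ i ]≔ s) j ⟩
  map f (v [ i ]≔ s) [ j ]≔ f s       ≡⟨ cong (_[ j ]≔ f s) (map-[]≔ f v i) ⟩
  (map f v [ i ]≔ f s) [ j ]≔ f s     ≡⟨ cong (λ y → (map f v [ i ]≔ y) [ j ]≔ y) f-s ⟩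
  move i j (map f v)                  ∎
  where
  open ≡-Reasoning
  s : ℕ
  s = lookup v i + lookup v j
  f-s : f s ≡ lookup (map f v) i + lookup (map f v) j
  f-s = trans (f-+ _ _) (sym (cong₂ _+_ (lookup-map i f v) (lookup-map j f v)))

move-⊕ : ∀ i j (u v : Vec ℕ n) → move i j (u ⊕ v) ≡ move i j u ⊕ move i j v
move-⊕ i j u v = begin
  move i j (u ⊕ v)                            ≡⟨ cong (λ y → ((u ⊕ v) [ i ]≔ y) [ j ]≔ y) split ⟩
  ((u ⊕ v) [ i ]≔ (s + t)) [ j ]≔ (s + t)         ≡⟨ cong (_[ j ]≔ (s + t)) (zipWith-[]≔ _+_ u v i s t) ⟨
  ((u [ i ]≔ s) ⊕ (v [ i ]≔ t)) [ j ]≔ (s + t)  ≡⟨ zipWith-[]≔ _+_ (u [ i ]≔ s) (v [ i ]≔ t) j s t ⟨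
  move i j u ⊕ move i j v                     ∎
  where
  open ≡-Reasoning
  s t : ℕ
  s = lookup u i + lookup u j
  t = lookup v i + lookup v j
  split : lookup (u ⊕ v) i + lookup (u ⊕ v) j ≡ s + t
  split = trans (cong₂ _+_ (lookup-zipWith _+_ i u v) (lookup-zipWith _+_ j u v))
                (interchange (lookup u i) (lookup v i) (lookup u j) (lookup v j))

permute-move : ∀ (ρ : Permutation′ n) i j (v : Vec ℕ n) →
               permute ρ (move i j v) ≡ move (ρ ⟨$⟩ˡ i) (ρ ⟨$⟩ˡ j) (permute ρ v)
permute-move ρ i j v = begin
  permute ρ ((v [ i ]≔ s) [ j ]≔ s)               ≡⟨ permute-[]≔ ρ (v [ i ]≔ s) j s ⟩
  permute ρ (v [ i ]≔ s) [ ρ ⟨$⟩ˡ j ]≔ s          ≡⟨ cong (_[ ρ ⟨$⟩ˡ j ]≔ s) (permute-[]≔ ρ v i s) ⟩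
  (permute ρ v [ ρ ⟨$⟩ˡ i ]≔ s) [ ρ ⟨$⟩ˡ j ]≔ s   ≡⟨ cong (λ y → (permute ρ v [ ρ ⟨$⟩ˡ i ]≔ y) [ ρ ⟨$⟩ˡ j ]≔ y) s≡ ⟩
  move (ρ ⟨$⟩ˡ i) (ρ ⟨$⟩ˡ j) (permute ρ v)        ∎
  where
  open ≡-Reasoning
  s : ℕ
  s = lookup v i + lookup v j
  s≡ : s ≡ lookup (permute ρ v) (ρ ⟨$⟩ˡ i) + lookup (permute ρ v) (ρ ⟨$⟩ˡ j)
  s≡ = sym (cong₂ _+_ (lookup-permute-⟨$⟩ˡ ρ v i) (lookup-permute-⟨$⟩ˡ ρ v j))

Reach-permute : ∀ (ρ : Permutation′ n) {v w} → Reach k v w → Reach k (permute ρ v) (permute ρ w)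
Reach-permute ρ done = done
Reach-permute ρ {v} (step (i , j , i≢j , refl) p) =
  step (ρ ⟨$⟩ˡ i , ρ ⟨$⟩ˡ j , ρˡi≢ρˡj , permute-move ρ i j v) (Reach-permute ρ p)
  where
  ρˡi≢ρˡj : ρ ⟨$⟩ˡ i ≢ ρ ⟨$⟩ˡ j
  ρˡi≢ρˡj e = i≢j (trans (sym (inverseʳ ρ)) (trans (cong (ρ ⟨$⟩ʳ_) e) (inverseʳ ρ)))

replay : {v w : Vec ℕ n} → Reach k v w → Vec ℕ n → Vec ℕ n
replay done                 u = u
replay (step (i , j , _) p) u = replay p (move i j u)

replay-reach : {v w : Vec ℕ n} (p : Reach k v w) → ∀ u → Reach k u (replay p u)
replay-reach done                         u = done
replay-reach (step (i , j , i≢j , refl) p) u = step (i , j , i≢j , refl) (replay-reach p (move i j u))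

replay-self : {v w : Vec ℕ n} (p : Reach k v w) → replay p v ≡ w
replay-self done                        = refl
replay-self (step (_ , _ , _ , refl) p) = replay-self p

replay-⊕ : {v w : Vec ℕ n} (p : Reach k v w) → ∀ u u′ → replay p (u ⊕ u′) ≡ replay p u ⊕ replay p u′
replay-⊕ done                 u u′ = refl
replay-⊕ (step (i , j , _) p) u u′ =
  trans (cong (replay p) (move-⊕ i j u u′)) (replay-⊕ p (move i j u) (move i j u′))

replay-· : {v w : Vec ℕ n} (p : Reach k v w) → ∀ c u → replay p (c · u) ≡ c · replay p u
replay-· done                 c u = refl
replay-· (step (i , j , _) p) c u =
  trans (cong (replay p) (sym (move-map (c *_) (*-distribˡ-+ c) i j u))) (replay-· p c (move i j u))

cost : {v w : Vec ℕ n} → Reach k v w → Vec ℕ n → ℕ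
cost p u = sum (replay p u)

cost-⊕-· : {v w : Vec ℕ n} (p : Reach k v w) → ∀ u c e → cost p (u ⊕ c · e) ≡ cost p u + c * cost p e
cost-⊕-· p u c e = begin
  sum (replay p (u ⊕ c · e))            ≡⟨ cong sum (replay-⊕ p u (c · e)) ⟩
  sum (replay p u ⊕ replay p (c · e))   ≡⟨ sum-⊕ (replay p u) (replay p (c · e)) ⟩
  cost p u + sum (replay p (c · e))     ≡⟨ cong (λ y → cost p u + sum y) (replay-· p c e) ⟩
  cost p u + sum (c · replay p e)       ≡⟨ cong (cost p u +_) (sum-· c (replay p e)) ⟩
  cost p u + c * cost p e               ∎
  where open ≡-Reasoning

cost-balance : {v w : Vec ℕ n} (p : Reach k v w) → ∀ {u u′ e e′} c → u ⊕ c · e ≡ u′ ⊕ c · e′ →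
               cost p u + c * cost p e ≡ cost p u′ + c * cost p e′
cost-balance p {u} {u′} {e} {e′} c eq = begin
  cost p u + c * cost p e     ≡⟨ cost-⊕-· p u c e ⟨
  cost p (u ⊕ c · e)          ≡⟨ cong (cost p) eq ⟩
  cost p (u′ ⊕ c · e′)        ≡⟨ cost-⊕-· p u′ c e′ ⟩
  cost p u′ + c * cost p e′   ∎
  where open ≡-Reasoning

≼-by-simulation : {S T : Vec ℕ n} →
                  (∀ {k w} → Reach k T w → ∃[ w′ ] Reach k S w′ × sum w′ ≤ sum w) → S ≼ T
≼-by-simulation simulate k o o′ (_ , o≤) ((w , p , refl) , _) with simulate p
... | w′ , q , w′≤w = ≤-trans (o≤ w′ q) w′≤w

≤-of-balance : ∀ {t s a b} c → t + c * a ≡ s + c * b → a ≤ b → s ≤ t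
≤-of-balance {t} {s} {a} {b} c balance a≤b = +-cancelʳ-≤ (c * a) s t (begin
  s + c * a  ≤⟨ +-monoʳ-≤ s (*-monoʳ-≤ c a≤b) ⟩
  s + c * b  ≡⟨ balance ⟨
  t + c * a  ∎)
  where open ≤-Reasoning

balances⇒≤⊎≤ : ∀ {t s s′ a b} δ ε → t + δ * b ≡ s + δ * a → t + ε * a ≡ s′ + ε * b → s ≤ t ⊎ s′ ≤ t
balances⇒≤⊎≤ {a = a} {b} δ ε balance₁ balance₂ with ≤-total b a
... | inj₁ b≤a = inj₁ (≤-of-balance δ balance₁ b≤a)
... | inj₂ a≤b = inj₂ (≤-of-balance ε balance₂ a≤b)

block : ℕ → ℕ → Vec ℕ 4
block p q = p ∷ p ∷ q ∷ q ∷ []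

pairs-closer : ∀ (xs : Vec ℕ m) x δ ε → (xs ++ block x (x + δ + ε)) ≼ (xs ++ block (x + δ) (x + ε))
pairs-closer {m} xs x δ ε = ≼-by-simulation simulate
  where
  S S′ T e₁ e₂ : Vec ℕ (m + 4)
  S  = xs ++ block x (x + δ + ε)
  S′ = xs ++ block (x + δ + ε) x
  T  = xs ++ block (x + δ) (x + ε)
  e₁ = replicate m 0 ++ block 1 0
  e₂ = replicate m 0 ++ block 0 1

  absorb : ∀ y c → y + c + c * 0 ≡ y + c * 1
  absorb = solve-∀
  shift₁ : ∀ x δ ε → x + ε + δ * 1 ≡ x + δ + ε + δ * 0
  shift₁ = solve-∀
  shift₂ : ∀ x δ ε → x + δ + ε * 1 ≡ x + δ + ε + ε * 0
  shift₂ = solve-∀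

  balance₁ : T ⊕ δ · e₂ ≡ S ⊕ δ · e₁
  balance₁ = begin
    T ⊕ δ · e₂                                         ≡⟨ ⊕-·-++-zeros xs _ _ δ ⟩
    xs ++ block (x + δ + δ * 0) (x + ε + δ * 1)        ≡⟨ cong (xs ++_) (cong₂ block (absorb x δ) (shift₁ x δ ε)) ⟩
    xs ++ block (x + δ * 1) (x + δ + ε + δ * 0)        ≡⟨ ⊕-·-++-zeros xs _ _ δ ⟨
    S ⊕ δ · e₁                                         ∎
    where open ≡-Reasoning

  balance₂ : T ⊕ ε · e₁ ≡ S′ ⊕ ε · e₂
  balance₂ = begin
    T ⊕ ε · e₁                                         ≡⟨ ⊕-·-++-zeros xs _ _ ε ⟩
    xs ++ block (x + δ + ε * 1) (x + ε + ε * 0)        ≡⟨ cong (xs ++_) (cong₂ block (shift₂ x δ ε) (absorb x ε)) ⟩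
    xs ++ block (x + δ + ε + ε * 0) (x + ε * 1)        ≡⟨ ⊕-·-++-zeros xs _ _ ε ⟨
    S′ ⊕ ε · e₂                                        ∎
    where open ≡-Reasoning

  -- Reversing p ∷ p ∷ q ∷ q ∷ [] gives q ∷ q ∷ p ∷ p ∷ [].
  swapPairs : Permutation′ (m + 4)
  swapPairs = onSuffix m reverse

  exchange : permute swapPairs S′ ≡ S
  exchange = permute-onSuffix reverse xs (block (x + δ + ε) x)

  simulate : ∀ {k w} → Reach k T w → ∃[ w′ ] Reach k S w′ × sum w′ ≤ sum w
  simulate {k} p
    with balances⇒≤⊎≤ δ ε (cost-balance p δ balance₁) (cost-balance p ε balance₂)
  ... | inj₁ S≤T = replay p S , replay-reach p S , subst (cost p S ≤_) (cong sum (replay-self p)) S≤T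
  ... | inj₂ S′≤T =
    permute swapPairs (replay p S′) ,
    subst (λ v → Reach k v (permute swapPairs (replay p S′))) exchange
          (Reach-permute swapPairs (replay-reach p S′)) ,
    subst₂ _≤_ (sym (sum-permute swapPairs (replay p S′))) (cong sum (replay-self p)) S′≤T

pairs-closer-≡ : ∀ (xs : Vec ℕ m) {x y z w} δ ε → x + δ ≡ y → x + ε ≡ z → y + ε ≡ w →
                 (xs ++ block x w) ≼ (xs ++ block y z)
pairs-closer-≡ xs {x} δ ε refl refl refl = pairs-closer xs x δ ε

lemma6 : (m : ℕ) (xs : Vec ℕ m) (a b c d : ℕ) →
    All (0 <_) xs → 0 < a → 0 < b → 0 < c → 0 < d →
    a ≤ b → b ≤ c → c ≤ d →
    ((xs ++ (a + b ∷ a + b ∷ c + d ∷ c + d ∷ [])) ≼ (xs ++ (a + c ∷ a + c ∷ b + d ∷ b + d ∷ [])))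
    × ((xs ++ (a + b ∷ a + b ∷ c + d ∷ c + d ∷ [])) ≼ (xs ++ (a + d ∷ a + d ∷ b + c ∷ b + c ∷ [])))
lemma6 m xs a b c d _ _ _ _ _ a≤b b≤c c≤d =
  toward-T (m≤n⇒∃[o]m+o≡n b≤c) (m≤n⇒∃[o]m+o≡n (≤-trans a≤b (≤-trans b≤c c≤d))) ,
  toward-U (m≤n⇒∃[o]m+o≡n (≤-trans b≤c c≤d)) (m≤n⇒∃[o]m+o≡n (≤-trans a≤b b≤c))
  where
  regroup₁ : ∀ a b ε → a + b + ε ≡ b + (a + ε)
  regroup₁ = solve-∀
  regroup₂ : ∀ a b δ ε → a + (b + δ) + ε ≡ b + δ + (a + ε)
  regroup₂ = solve-∀
  regroup₃ : ∀ a b δ ε → a + (b + δ) + ε ≡ a + ε + (b + δ)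
  regroup₃ = solve-∀

  toward-T : ∀ {c d} → ∃[ δ ] b + δ ≡ c → ∃[ ε ] a + ε ≡ d →
             (xs ++ block (a + b) (c + d)) ≼ (xs ++ block (a + c) (b + d))
  toward-T (δ , refl) (ε , refl) =
    pairs-closer-≡ xs δ ε (+-assoc a b δ) (regroup₁ a b ε) (regroup₂ a b δ ε)

  toward-U : ∀ {c d} → ∃[ δ ] b + δ ≡ d → ∃[ ε ] a + ε ≡ c →
             (xs ++ block (a + b) (c + d)) ≼ (xs ++ block (a + d) (b + c))
  toward-U (δ , refl) (ε , refl) =
    pairs-closer-≡ xs δ ε (+-assoc a b δ) (regroup₁ a b ε) (regroup₃ a b δ ε)
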